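{- For all integers $d\geq k\geq 2$ we have $\mathrm{ex}(n,H_d^{(k)})\leq O_{d,k}\left(n^{k-1/d}\right)$ and $d_1(H_d^{(k)})=d$.
   Context: For $k\geq 2$ and $d\geq 1$, the bipartite hedgehog $H_d^{(k)}$ is the $k$-uniform $k$-partite hypergraph with vertex set $[d]\sqcup[d]\sqcup\bigsqcup_{i=1}^{k-2}[d]^2$ and the $d^2$ edges $\{i, j, (i,j), \ldots, (i,j)\}$ for $(i,j)\in[d]^2$, where $i$ is in the first copy of $[d]$, $j$ in the second, and the copy of $(i,j)$ in each of the $k-2$ copies of $[d]^2$ (i.e., each edge of $K_{d,d}$ extended by $k-2$ new vertices). The skeletal degeneracy $d_1(H)$ is the degeneracy of the $1$-skeleton of $H$ (the graph on $V(H)$ joining two vertices iff they lie in a common edge of $H$). $\mathrm{ex}(n,H)$ is the maximum number of edges in an $n$-vertex $k$-uniform hypergraph with no copy of $H$. $O_{d,k}(f(n))$ denotes a quantity at most $Cf(n)$ with $C$ depending only on $d,k$. -}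

module Defs where

open import Level using (Level; _⊔_) renaming (suc to lsuc; zero to lzero)
open import Data.Nat using (ℕ; zero; suc; _+_; _*_; _∸_; _^_; _≤_)
open import Data.Fin using (Fin)
open import Data.Fin.Subset using (Subset; _∈_; ∣_∣)
open import Data.Bool using (Bool; true)
open import Data.Product using (Σ; ∃; ∃-syntax; _×_; _,_)
open import Data.Sum using (_⊎_; inj₁; inj₂)
open import Data.List using (List; length)
open import Data.List.Relation.Unary.All using (All)
open import Data.List.Relation.Unary.Unique.Propositional using (Unique)
import Data.List.Membership.Propositional as LM
open import Relation.Nullary using (¬_)
open import Relation.Binary.PropositionalEquality using (_≡_; _≢_)
open import Function.Definitions using (Injective)
open import Function.Bundles using (_⇔_)

record Hypergraph : Set₁ where
  field
    Vertex : Set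
    Edge   : Set
    _∈ₑ_   : Vertex → Edge → Set
open Hypergraph public

IsUniformHypergraph : (n k : ℕ) → List (Subset n) → Set
IsUniformHypergraph n k E = Unique E × All (λ e → ∣ e ∣ ≡ k) E

Contains : (n : ℕ) → List (Subset n) → Hypergraph → Set
Contains n E H =
  Σ (Vertex H → Fin n) λ f →
    Injective _≡_ _≡_ f ×
    ((e : Edge H) → Σ (Subset n) λ e' → (e' LM.∈ E) ×
       ((x : Fin n) → (x ∈ e') ⇔ (∃[ v ] ((_∈ₑ_ H v e) × f v ≡ x))))

HedgehogVertex : (d k : ℕ) → Set
HedgehogVertex d k = Fin d ⊎ (Fin d ⊎ (Fin (k ∸ 2) × Fin d × Fin d))

data HedgehogMember (d k : ℕ) : HedgehogVertex d k → Fin d × Fin d → Set where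
  first  : ∀ i j → HedgehogMember d k (inj₁ i) (i , j)
  second : ∀ i j → HedgehogMember d k (inj₂ (inj₁ j)) (i , j)
  extra  : ∀ t i j → HedgehogMember d k (inj₂ (inj₂ (t , i , j))) (i , j)

Hedgehog : (d k : ℕ) → Hypergraph
Hedgehog d k = record
  { Vertex = HedgehogVertex d k
  ; Edge   = Fin d × Fin d
  ; _∈ₑ_   = HedgehogMember d k
  }

SkeletonAdj : (H : Hypergraph) → Vertex H → Vertex H → Set
SkeletonAdj H u v = u ≢ v × ∃[ e ] (_∈ₑ_ H u e × _∈ₑ_ H v e)

AtLeastNeighbours : {V : Set} → (V → V → Set) → (V → Bool) → V → ℕ → Set
AtLeastNeighbours {V} Adj S v m =
  Σ (Fin m → V) λ g → Injective _≡_ _≡_ g ×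
    ((i : Fin m) → (S (g i) ≡ true) × Adj v (g i))

IsDegenerate : {V : Set} → (V → V → Set) → ℕ → Set
IsDegenerate {V} Adj m =
  (S : V → Bool) → (∃[ v ] S v ≡ true) →
    ∃[ v ] ((S v ≡ true) × ¬ AtLeastNeighbours Adj S v (suc m))

HasDegeneracy : {V : Set} → (V → V → Set) → ℕ → Set
HasDegeneracy Adj m = IsDegenerate Adj m × ((m' : ℕ) → IsDegenerate Adj m' → m ≤ m')

HasSkeletalDegeneracy : Hypergraph → ℕ → Set
HasSkeletalDegeneracy H m = HasDegeneracy (SkeletonAdj H) m

-- ex(n, H) ≤ C · n^(k - 1/d), written without real exponents as
-- ex(n,H)^d ≤ C · n^(k d - 1) (constant C^d absorbed into C).
ExBound : (k d : ℕ) → Hypergraph → Set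
ExBound k d H =
  ∃[ C ] ((n : ℕ) (E : List (Subset n)) → IsUniformHypergraph n k E →
     ¬ Contains n E H → length E ^ d ≤ C * n ^ (k * d ∸ 1))

{-# OPTIONS --safe #-}
-- Call a pair of host vertices heavy when its codegree exceeds s·B, where s = 2d + d²(k-2) is the
-- number of vertices of the hedgehog and B ≈ n^(k-3) bounds the codegree of three points.  A K_{d,d}
-- of heavy pairs extends greedily to a hedgehog: each of its d² pairs lies in an edge missing the
-- at most s vertices used so far, as each used vertex meets at most B of the edges through the
-- pair.  So in a hedgehog-free host the heavy pairs span no K_{d,d}, hence by Kővári–Sós–Turán only
-- O(n^(2-1/d)) of them, each of codegree at most n^(k-2), while light pairs carry at most
-- n²·s·B = O(n^(k-1)) edges: |E| = O(n^(k-1/d)).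
-- In the 1-skeleton each of the k - 2 vertices added to an edge (its spines) sees only the other
-- k - 1 < d vertices of that edge, and without spines what remains is K_{d,d}, which is d-regular:
-- the degeneracy is exactly d.

module Submission where

open import Defs
open import Data.Nat using (ℕ; _≤_)
open import Data.Product using (_×_)

open import Data.Bool using (Bool; true; false; _∧_; _∨_)
import Data.Bool as Bool
open import Data.Bool.Properties using (¬-not)
open import Data.Empty using (⊥-elim)
open import Data.Fin using (Fin; zero; suc; _≟_; lift; combine; remQuot; inject≤; fromℕ<)
import Data.Fin.Properties as Finₚ
open import Data.Fin.Subset using (Subset; inside; outside; _∈_; _∉_; _⊆_; _─_; _-_; ⁅_⁆; ∣_∣)
open import Data.Fin.Subset.Properties using (_∈?_; p─⊥≡p; x∈⁅x⁆; p─q⊆p; x∈p∧x≢y⇒x∈p-y; ⊆-antisym)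
open import Data.List using (List; []; _∷_; _++_; length; map; filter; tabulate)
open import Data.List.Properties using (length-map; length-++; length-tabulate; filter-none)
open import Data.List.Membership.Propositional using () renaming (_∈_ to _∈ₗ_; _∉_ to _∉ₗ_)
open import Data.List.Membership.Propositional.Properties using (∈-filter⁻; ∈-++⁺ˡ; ∈-++⁺ʳ; ∈-tabulate⁺)
open import Data.List.Relation.Unary.All using (All; []; _∷_)
import Data.List.Relation.Unary.All as All
import Data.List.Relation.Unary.All.Properties as All
open import Data.List.Relation.Unary.AllPairs using ([]; _∷_)
open import Data.List.Relation.Unary.Any using () renaming (here to hereₗ; there to thereₗ)
open import Data.List.Relation.Unary.Unique.Propositional using (Unique)
import Data.List.Relation.Unary.Unique.Propositional.Properties as Unique
open import Data.Nat using (zero; suc; _+_; _*_; _^_; _⊔_; _∸_; _<_; _<?_; _≤?_; z≤n; s≤s; NonZero)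
open import Data.Nat.Properties hiding (_≟_)
open import Algebra.Properties.Semiring.Sum +-*-semiring
  using (sum; sum-syntax; sum-cong-≗; ∑-distrib-+; ∑-comm; *-distribˡ-sum; *-distribʳ-sum)
open import Data.Nat.Solver using (module +-*-Solver)
open import Data.Product using (Σ; ∃-syntax; _,_; proj₁; proj₂)
open import Data.Sum using (_⊎_; inj₁; inj₂)
open import Data.Sum.Properties using (inj₁-injective; inj₂-injective)
open import Data.Vec using (Vec; []; _∷_; lookup; head; tail; here; there)
open import Function using (_∘_)
open import Function.Bundles using (mk⇔)
open import Function.Definitions using (Injective)
open import Level using (0ℓ)
open import Relation.Binary.PropositionalEquality
open import Relation.Nullary using (¬_; Dec; yes; no; does; ¬?; _×-dec_)
open import Relation.Nullary.Decidable using (dec-true)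
open import Relation.Unary using (Pred; Decidable)

open +-*-Solver

𝟙 : Bool → ℕ
𝟙 true  = 1
𝟙 false = 0

𝟙≤1 : ∀ b → 𝟙 b ≤ 1
𝟙≤1 true  = ≤-refl
𝟙≤1 false = z≤n

𝟙-∧ : ∀ a b → 𝟙 (a ∧ b) ≡ 𝟙 a * 𝟙 b
𝟙-∧ true  b = sym (+-identityʳ (𝟙 b))
𝟙-∧ false b = refl

𝟙-∨ : ∀ a b → 𝟙 (a ∨ b) ≤ 𝟙 a + 𝟙 b
𝟙-∨ true  b = s≤s z≤n
𝟙-∨ false b = ≤-refl

does≡true⇒ : ∀ {P : Set} (p? : Dec P) → does p? ≡ true → P
does≡true⇒ (yes p) _ = p

∑-mono-≤ : ∀ {n} {f g : Fin n → ℕ} → (∀ i → f i ≤ g i) → sum f ≤ sum g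
∑-mono-≤ {zero}  f≤g = z≤n
∑-mono-≤ {suc n} {f} {g} f≤g = +-mono-≤ (f≤g zero) (∑-mono-≤ {f = f ∘ suc} {g ∘ suc} (f≤g ∘ suc))

∑-const : ∀ n c → ∑[ i < n ] c ≡ n * c
∑-const zero    c = refl
∑-const (suc n) c = cong (c +_) (∑-const n c)

≤-∑ : ∀ {n} (f : Fin n → ℕ) i → f i ≤ sum f
≤-∑ f zero    = m≤m+n _ _
≤-∑ f (suc i) = ≤-trans (≤-∑ (λ j → f (suc j)) i) (m≤n+m _ _)

∑-≟ : ∀ {n} (y : Fin n) → ∑[ x < n ] 𝟙 (does (x ≟ y)) ≡ 1
∑-≟ {suc n} zero    = cong suc (trans (∑-const n 0) (*-zeroʳ n))
∑-≟ {suc n} (suc y) = ∑-≟ y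

count≥⇒injection : ∀ {n} m (p : Fin n → Bool) → m ≤ ∑[ x < n ] 𝟙 (p x) →
                   Σ (Fin m → Fin n) λ g → Injective _≡_ _≡_ g × (∀ i → p (g i) ≡ true)
count≥⇒injection zero p _ = (λ ()) , (λ { {()} }) , λ ()
count≥⇒injection {suc n} (suc m) p m≤count with p zero in p0
... | true  = let g , g-inj , pg = count≥⇒injection m (p ∘ suc) (≤-pred m≤count)
              in lift 1 g , Finₚ.lift-injective g g-inj 1 , λ { zero → p0 ; (suc i) → pg i }
... | false = let g , g-inj , pg = count≥⇒injection (suc m) (p ∘ suc) m≤count
              in suc ∘ g , g-inj ∘ Finₚ.suc-injective , pg

*-+-rearrange : ∀ {a b c e} → a ≤ b → c ≤ e → a * e + b * c ≤ a * c + b * e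
*-+-rearrange {a} {b} {c} {e} a≤b c≤e with m≤n⇒∃[o]m+o≡n a≤b | m≤n⇒∃[o]m+o≡n c≤e
... | p , refl | q , refl = ≤-trans (m≤m+n _ (p * q)) (≤-reflexive
  (solve 4 (λ a p c q → a :* (c :+ q) :+ (a :+ p) :* c :+ p :* q := a :* c :+ (a :+ p) :* (c :+ q))
         refl a p c q))

m+m≤n+n⇒m≤n : ∀ {m n} → m + m ≤ n + n → m ≤ n
m+m≤n+n⇒m≤n {m} {n} le with m ≤? n
... | yes m≤n = m≤n
... | no  m≰n = ⊥-elim (<⇒≱ (+-mono-< (≰⇒> m≰n) (≰⇒> m≰n)) le)

chebyshev : ∀ {n} (f g : Fin n → ℕ) → (∀ i j → f i ≤ f j → g i ≤ g j) →
            sum f * sum g ≤ n * ∑[ i < n ] (f i * g i)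
chebyshev {n} f g similarlyOrdered = m+m≤n+n⇒m≤n (begin
    F * G + F * G
  ≡⟨ cong₂ _+_ (sym ∑∑fg) (sym (trans (∑-comm (λ i j → f j * g i)) ∑∑fg)) ⟩
    ∑[ i < n ] ∑[ j < n ] (f i * g j) + ∑[ i < n ] ∑[ j < n ] (f j * g i)
  ≡⟨ sym (∑∑-distrib-+ (λ i j → f i * g j) (λ i j → f j * g i)) ⟩
    ∑[ i < n ] ∑[ j < n ] (f i * g j + f j * g i)
  ≤⟨ ∑-mono-≤ (λ i → ∑-mono-≤ (λ j → pairwise i j)) ⟩
    ∑[ i < n ] ∑[ j < n ] (f i * g i + f j * g j)
  ≡⟨ ∑∑-distrib-+ (λ i j → f i * g i) (λ i j → f j * g j) ⟩
    ∑[ i < n ] ∑[ j < n ] (f i * g i) + ∑[ i < n ] ∑[ j < n ] (f j * g j)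
  ≡⟨ cong₂ _+_ (trans (sum-cong-≗ (λ i → ∑-const n (f i * g i))) (sym (*-distribˡ-sum n (λ i → f i * g i))))
               (∑-const n S) ⟩
    n * S + n * S ∎)
  where
  open ≤-Reasoning
  F G S : ℕ
  F = sum f
  G = sum g
  S = ∑[ i < n ] (f i * g i)
  ∑∑fg : ∑[ i < n ] ∑[ j < n ] (f i * g j) ≡ F * G
  ∑∑fg = trans (sum-cong-≗ (λ i → sym (*-distribˡ-sum (f i) g))) (sym (*-distribʳ-sum G f))
  ∑∑-distrib-+ : (h h′ : Fin n → Fin n → ℕ) →
    ∑[ i < n ] ∑[ j < n ] (h i j + h′ i j) ≡ ∑[ i < n ] ∑[ j < n ] h i j + ∑[ i < n ] ∑[ j < n ] h′ i j
  ∑∑-distrib-+ h h′ = trans (sum-cong-≗ (λ i → ∑-distrib-+ (h i) (h′ i)))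
                            (∑-distrib-+ (λ i → sum (h i)) (λ i → sum (h′ i)))
  pairwise : ∀ i j → f i * g j + f j * g i ≤ f i * g i + f j * g j
  pairwise i j with ≤-total (f i) (f j)
  ... | inj₁ fi≤fj = *-+-rearrange fi≤fj (similarlyOrdered i j fi≤fj)
  ... | inj₂ fj≤fi = begin
      f i * g j + f j * g i ≡⟨ +-comm (f i * g j) _ ⟩
      f j * g i + f i * g j ≤⟨ *-+-rearrange fj≤fi (similarlyOrdered j i fj≤fi) ⟩
      f j * g j + f i * g i ≡⟨ +-comm (f j * g j) _ ⟩
      f i * g i + f j * g j ∎

power-mean : ∀ {n} (f : Fin n → ℕ) r → sum f ^ suc r ≤ n ^ r * ∑[ i < n ] (f i ^ suc r)
power-mean {n} f zero = ≤-reflexive (begin-equality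
    sum f * 1                   ≡⟨ *-identityʳ (sum f) ⟩
    sum f                       ≡⟨ sum-cong-≗ (λ i → sym (*-identityʳ (f i))) ⟩
    ∑[ i < n ] (f i * 1)        ≡⟨ sym (+-identityʳ _) ⟩
    ∑[ i < n ] (f i * 1) + 0    ∎)
  where open ≤-Reasoning
power-mean {n} f (suc r) = begin
    F * F ^ suc r
  ≤⟨ *-monoʳ-≤ F (power-mean f r) ⟩
    F * (n ^ r * P)
  ≡⟨ solve 3 (λ F a b → F :* (a :* b) := a :* (F :* b)) refl F (n ^ r) P ⟩
    n ^ r * (F * P)
  ≤⟨ *-monoʳ-≤ (n ^ r) (chebyshev f (λ i → f i ^ suc r) (λ i j → ^-monoˡ-≤ (suc r))) ⟩
    n ^ r * (n * ∑[ i < n ] (f i * f i ^ suc r))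
  ≡⟨ sym (*-assoc (n ^ r) n _) ⟩
    n ^ r * n * ∑[ i < n ] (f i ^ suc (suc r))
  ≡⟨ cong (_* ∑[ i < n ] (f i ^ suc (suc r))) (*-comm (n ^ r) n) ⟩
    n ^ suc r * ∑[ i < n ] (f i ^ suc (suc r)) ∎
  where
  open ≤-Reasoning
  F P : ℕ
  F = sum f
  P = ∑[ i < n ] (f i ^ suc r)

^-distribʳ-* : ∀ x y e → (x * y) ^ e ≡ x ^ e * y ^ e
^-distribʳ-* x y zero    = refl
^-distribʳ-* x y (suc e) = begin
  x * y * (x * y) ^ e       ≡⟨ cong (x * y *_) (^-distribʳ-* x y e) ⟩
  x * y * (x ^ e * y ^ e)   ≡⟨ solve 4 (λ x y a b → x :* y :* (a :* b) := x :* a :* (y :* b)) refl x y (x ^ e) (y ^ e) ⟩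
  x * x ^ e * (y * y ^ e)   ∎
  where open ≡-Reasoning

+-^-≤ : ∀ x y e → (x + y) ^ e ≤ 2 ^ e * (x ^ e + y ^ e)
+-^-≤ x y e = begin
    (x + y) ^ e
  ≤⟨ ^-monoˡ-≤ e (≤-trans (+-mono-≤ (m≤m⊔n x y) (m≤n⊔m x y))
                          (≤-reflexive (cong (x ⊔ y +_) (sym (+-identityʳ (x ⊔ y)))))) ⟩
    (2 * (x ⊔ y)) ^ e
  ≡⟨ ^-distribʳ-* 2 (x ⊔ y) e ⟩
    2 ^ e * (x ⊔ y) ^ e
  ≤⟨ *-monoʳ-≤ (2 ^ e) max≤ ⟩
    2 ^ e * (x ^ e + y ^ e) ∎
  where
  open ≤-Reasoning
  max≤ : (x ⊔ y) ^ e ≤ x ^ e + y ^ e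
  max≤ with ⊔-sel x y
  ... | inj₁ eq = subst (λ m → m ^ e ≤ x ^ e + y ^ e) (sym eq) (m≤m+n _ _)
  ... | inj₂ eq = subst (λ m → m ^ e ≤ x ^ e + y ^ e) (sym eq) (m≤n+m _ _)

-- The Kővári–Sós–Turán theorem

∑ᵗ : ∀ n r → (Vec (Fin n) r → ℕ) → ℕ
∑ᵗ n zero    h = h []
∑ᵗ n (suc r) h = ∑[ x < n ] ∑ᵗ n r (λ w → h (x ∷ w))

module _ {n : ℕ} where

  ∑ᵗ-cong : ∀ r {h h′ : Vec (Fin n) r → ℕ} → (∀ w → h w ≡ h′ w) → ∑ᵗ n r h ≡ ∑ᵗ n r h′
  ∑ᵗ-cong zero    eq = eq []
  ∑ᵗ-cong (suc r) eq = sum-cong-≗ (λ x → ∑ᵗ-cong r (λ w → eq (x ∷ w)))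

  ∑ᵗ-mono-≤ : ∀ r {h h′ : Vec (Fin n) r → ℕ} → (∀ w → h w ≤ h′ w) → ∑ᵗ n r h ≤ ∑ᵗ n r h′
  ∑ᵗ-mono-≤ zero    le = le []
  ∑ᵗ-mono-≤ (suc r) le = ∑-mono-≤ (λ x → ∑ᵗ-mono-≤ r (λ w → le (x ∷ w)))

  *-distribˡ-∑ᵗ : ∀ r c (h : Vec (Fin n) r → ℕ) → ∑ᵗ n r (λ w → c * h w) ≡ c * ∑ᵗ n r h
  *-distribˡ-∑ᵗ zero    c h = refl
  *-distribˡ-∑ᵗ (suc r) c h =
    trans (sum-cong-≗ {n} (λ x → *-distribˡ-∑ᵗ r c _)) (sym (*-distribˡ-sum c (λ x → ∑ᵗ n r (λ w → h (x ∷ w)))))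

  ∑ᵗ-distrib-+ : ∀ r (h h′ : Vec (Fin n) r → ℕ) → ∑ᵗ n r (λ w → h w + h′ w) ≡ ∑ᵗ n r h + ∑ᵗ n r h′
  ∑ᵗ-distrib-+ zero    h h′ = refl
  ∑ᵗ-distrib-+ (suc r) h h′ = trans (sum-cong-≗ {n} (λ x → ∑ᵗ-distrib-+ r _ _))
    (∑-distrib-+ (λ x → ∑ᵗ n r (λ w → h (x ∷ w))) (λ x → ∑ᵗ n r (λ w → h′ (x ∷ w))))

  ∑ᵗ-const : ∀ r c → ∑ᵗ n r (λ _ → c) ≡ c * n ^ r
  ∑ᵗ-const zero    c = sym (*-identityʳ c)
  ∑ᵗ-const (suc r) c = begin
    ∑[ x < n ] ∑ᵗ n r (λ _ → c) ≡⟨ sum-cong-≗ {n} (λ x → ∑ᵗ-const r c) ⟩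
    ∑[ x < n ] (c * n ^ r)      ≡⟨ ∑-const n (c * n ^ r) ⟩
    n * (c * n ^ r)             ≡⟨ solve 3 (λ n c p → n :* (c :* p) := c :* (n :* p)) refl n c (n ^ r) ⟩
    c * n ^ suc r               ∎
    where open ≡-Reasoning

  ∑-∑ᵗ-comm : ∀ r (h : Fin n → Vec (Fin n) r → ℕ) →
              ∑[ u < n ] ∑ᵗ n r (h u) ≡ ∑ᵗ n r (λ w → ∑[ u < n ] h u w)
  ∑-∑ᵗ-comm zero    h = refl
  ∑-∑ᵗ-comm (suc r) h = trans (∑-comm (λ u x → ∑ᵗ n r (λ w → h u (x ∷ w))))
                              (sum-cong-≗ {n} (λ x → ∑-∑ᵗ-comm r (λ u w → h u (x ∷ w))))

  occurs : ∀ {r} → Fin n → Vec (Fin n) r → Bool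
  occurs x []      = false
  occurs x (y ∷ w) = does (x ≟ y) ∨ occurs x w

  hasRepeat : ∀ {r} → Vec (Fin n) r → Bool
  hasRepeat []      = false
  hasRepeat (x ∷ w) = occurs x w ∨ hasRepeat w

  occurs≡false⇒≢ : ∀ {r x} (w : Vec (Fin n) r) → occurs x w ≡ false → ∀ j → x ≢ lookup w j
  occurs≡false⇒≢ {x = x} (y ∷ w) eq j with x ≟ y
  occurs≡false⇒≢ (y ∷ w) eq zero    | no x≢y = x≢y
  occurs≡false⇒≢ (y ∷ w) eq (suc j) | no x≢y = occurs≡false⇒≢ w eq j

  lookup-injective : ∀ {r} (w : Vec (Fin n) r) → hasRepeat w ≡ false → Injective _≡_ _≡_ (lookup w)
  lookup-injective (x ∷ w) eq {i} {j} p with occurs x w in x∉w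
  lookup-injective (x ∷ w) ()                 _ | true
  lookup-injective (x ∷ w) eq {zero}  {zero}  _ | false = refl
  lookup-injective (x ∷ w) eq {zero}  {suc j} p | false = ⊥-elim (occurs≡false⇒≢ w x∉w j p)
  lookup-injective (x ∷ w) eq {suc i} {zero}  p | false = ⊥-elim (occurs≡false⇒≢ w x∉w i (sym p))
  lookup-injective (x ∷ w) eq {suc i} {suc j} p | false = cong suc (lookup-injective w eq p)

  ∑-occurs≤ : ∀ {r} (w : Vec (Fin n) r) → ∑[ x < n ] 𝟙 (occurs x w) ≤ r
  ∑-occurs≤ []      = ≤-reflexive (trans (∑-const n 0) (*-zeroʳ n))
  ∑-occurs≤ (y ∷ w) = begin
    ∑[ x < n ] 𝟙 (does (x ≟ y) ∨ occurs x w)             ≤⟨ ∑-mono-≤ (λ x → 𝟙-∨ (does (x ≟ y)) _) ⟩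
    ∑[ x < n ] (𝟙 (does (x ≟ y)) + 𝟙 (occurs x w))       ≡⟨ ∑-distrib-+ (λ x → 𝟙 (does (x ≟ y))) _ ⟩
    ∑[ x < n ] 𝟙 (does (x ≟ y)) + ∑[ x < n ] 𝟙 (occurs x w) ≤⟨ +-mono-≤ (≤-reflexive (∑-≟ y)) (∑-occurs≤ w) ⟩
    suc _                                                 ∎
    where open ≤-Reasoning

  repeating-tuples : ∀ r → n * ∑ᵗ n r (𝟙 ∘ hasRepeat) ≤ r * r * n ^ r
  repeating-tuples zero    = ≤-reflexive (*-zeroʳ n)
  repeating-tuples (suc r) = begin
      n * ∑[ x < n ] ∑ᵗ n r (λ w → 𝟙 (occurs x w ∨ hasRepeat w))
    ≤⟨ *-monoʳ-≤ n (∑-mono-≤ (λ x → ∑ᵗ-mono-≤ r (λ w → 𝟙-∨ (occurs x w) (hasRepeat w)))) ⟩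
      n * ∑[ x < n ] ∑ᵗ n r (λ w → 𝟙 (occurs x w) + 𝟙 (hasRepeat w))
    ≡⟨ cong (n *_) (trans (sum-cong-≗ {n} (λ x → ∑ᵗ-distrib-+ r _ _))
                          (∑-distrib-+ (λ x → ∑ᵗ n r (λ w → 𝟙 (occurs x w))) (λ _ → N))) ⟩
      n * (∑[ x < n ] ∑ᵗ n r (λ w → 𝟙 (occurs x w)) + ∑[ x < n ] N)
    ≡⟨ cong (λ z → n * (z + ∑[ x < n ] N)) (∑-∑ᵗ-comm r (λ x w → 𝟙 (occurs x w))) ⟩
      n * (∑ᵗ n r (λ w → ∑[ x < n ] 𝟙 (occurs x w)) + ∑[ x < n ] N)
    ≤⟨ *-monoʳ-≤ n (+-mono-≤ (∑ᵗ-mono-≤ r ∑-occurs≤) (≤-reflexive (∑-const n N))) ⟩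
      n * (∑ᵗ n r (λ _ → r) + n * N)
    ≡⟨ cong (λ z → n * (z + n * N)) (∑ᵗ-const r r) ⟩
      n * (r * n ^ r + n * N)
    ≤⟨ *-monoʳ-≤ n (+-monoʳ-≤ (r * n ^ r) (repeating-tuples r)) ⟩
      n * (r * n ^ r + r * r * n ^ r)
    ≡⟨ solve 3 (λ n r p → n :* (r :* p :+ r :* r :* p) := (r :+ r :* r) :* (n :* p)) refl n r (n ^ r) ⟩
      (r + r * r) * n ^ suc r
    ≤⟨ *-monoˡ-≤ (n ^ suc r) (≤-trans (m≤n+m (r + r * r) (suc r))
         (≤-reflexive (solve 1 (λ r → con 1 :+ r :+ (r :+ r :* r) := (con 1 :+ r) :* (con 1 :+ r)) refl r))) ⟩
      suc r * suc r * n ^ suc r ∎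
    where
    open ≤-Reasoning
    N : ℕ
    N = ∑ᵗ n r (𝟙 ∘ hasRepeat)

module KőváriSósTurán {n : ℕ} (adj : Fin n → Fin n → Bool) where

  HasBiclique : ℕ → Set
  HasBiclique d = Σ (Fin d → Fin n) λ a → Σ (Fin d → Fin n) λ b →
    Injective _≡_ _≡_ a × Injective _≡_ _≡_ b × (∀ i j → adj (a i) (b j) ≡ true)

  degree : Fin n → ℕ
  degree u = ∑[ v < n ] 𝟙 (adj u v)

  adjacentToAll : ∀ {r} → Fin n → Vec (Fin n) r → Bool
  adjacentToAll u []      = true
  adjacentToAll u (x ∷ w) = adj u x ∧ adjacentToAll u w

  adjacentToAll⇒adj : ∀ {r} u (w : Vec (Fin n) r) → adjacentToAll u w ≡ true →
                      ∀ j → adj u (lookup w j) ≡ true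
  adjacentToAll⇒adj u (x ∷ w) all j with adj u x in u~x
  adjacentToAll⇒adj u (x ∷ w) all zero    | true = u~x
  adjacentToAll⇒adj u (x ∷ w) all (suc j) | true = adjacentToAll⇒adj u w all j

  ∑ᵗ-adjacentToAll : ∀ r u → ∑ᵗ n r (𝟙 ∘ adjacentToAll u) ≡ degree u ^ r
  ∑ᵗ-adjacentToAll zero    u = refl
  ∑ᵗ-adjacentToAll (suc r) u = begin
      ∑[ x < n ] ∑ᵗ n r (λ w → 𝟙 (adj u x ∧ adjacentToAll u w))
    ≡⟨ sum-cong-≗ {n} (λ x → trans (∑ᵗ-cong r (λ w → 𝟙-∧ (adj u x) _))
                                   (*-distribˡ-∑ᵗ r (𝟙 (adj u x)) (𝟙 ∘ adjacentToAll u))) ⟩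
      ∑[ x < n ] (𝟙 (adj u x) * ∑ᵗ n r (𝟙 ∘ adjacentToAll u))
    ≡⟨ sum-cong-≗ {n} (λ x → cong (𝟙 (adj u x) *_) (∑ᵗ-adjacentToAll r u)) ⟩
      ∑[ x < n ] (𝟙 (adj u x) * degree u ^ r)
    ≡⟨ sym (*-distribʳ-sum (degree u ^ r) (λ x → 𝟙 (adj u x))) ⟩
      degree u ^ suc r ∎
    where open ≡-Reasoning

  -- A tuple of r + 1 distinct vertices with r + 1 common neighbours would span K_{r+1,r+1}.
  common-neighbours≤ : ∀ r → ¬ HasBiclique (suc r) → (w : Vec (Fin n) (suc r)) →
                       ∑[ u < n ] 𝟙 (adjacentToAll u w) ≤ r + n * 𝟙 (hasRepeat w)
  common-neighbours≤ r noBiclique w with hasRepeat w in rep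
  ... | true  = ≤-trans (∑-mono-≤ (λ u → 𝟙≤1 (adjacentToAll u w)))
                        (≤-trans (≤-reflexive (∑-const n 1)) (m≤n+m (n * 1) r))
  ... | false with ∑[ u < n ] 𝟙 (adjacentToAll u w) ≤? r
  ...   | yes few = ≤-trans few (≤-reflexive (sym (trans (cong (r +_) (*-zeroʳ n)) (+-identityʳ r))))
  ...   | no many with count≥⇒injection (suc r) (λ u → adjacentToAll u w) (≰⇒> many)
  ...     | a , a-inj , a~w = ⊥-elim (noBiclique
              (a , lookup w , a-inj , lookup-injective w rep , λ i → adjacentToAll⇒adj (a i) w (a~w i)))

  -- Double count the pairs (u, w) with w an (r+1)-tuple of neighbours of u.
  kővári-sós-turán : ∀ r → ¬ HasBiclique (suc r) →
                     (∑[ u < n ] degree u) ^ suc r ≤ (r + suc r * suc r) * n ^ (r + suc r)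
  kővári-sós-turán r noBiclique = begin
      (∑[ u < n ] degree u) ^ suc r
    ≤⟨ power-mean degree r ⟩
      n ^ r * ∑[ u < n ] (degree u ^ suc r)
    ≡⟨ cong (n ^ r *_) (trans (sum-cong-≗ {n} (λ u → sym (∑ᵗ-adjacentToAll (suc r) u)))
                              (∑-∑ᵗ-comm {n} (suc r) (λ u w → 𝟙 (adjacentToAll u w)))) ⟩
      n ^ r * ∑ᵗ n (suc r) (λ w → ∑[ u < n ] 𝟙 (adjacentToAll u w))
    ≤⟨ *-monoʳ-≤ (n ^ r) (∑ᵗ-mono-≤ {n} (suc r) (common-neighbours≤ r noBiclique)) ⟩
      n ^ r * ∑ᵗ n (suc r) (λ w → r + n * 𝟙 (hasRepeat w))
    ≡⟨ cong (n ^ r *_) (trans (∑ᵗ-distrib-+ {n} (suc r) (λ _ → r) (λ w → n * 𝟙 (hasRepeat w)))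
                              (cong₂ _+_ (∑ᵗ-const {n} (suc r) r) (*-distribˡ-∑ᵗ {n} (suc r) n (𝟙 ∘ hasRepeat)))) ⟩
      n ^ r * (r * n ^ suc r + n * ∑ᵗ n (suc r) (𝟙 ∘ hasRepeat))
    ≤⟨ *-monoʳ-≤ (n ^ r) (+-monoʳ-≤ (r * n ^ suc r) (repeating-tuples {n} (suc r))) ⟩
      n ^ r * (r * n ^ suc r + suc r * suc r * n ^ suc r)
    ≡⟨ solve 4 (λ a r D b → a :* (r :* b :+ D :* b) := (r :+ D) :* (a :* b)) refl (n ^ r) r (suc r * suc r) (n ^ suc r) ⟩
      (r + suc r * suc r) * (n ^ r * n ^ suc r)
    ≡⟨ cong ((r + suc r * suc r) *_) (sym (^-distribˡ-+-* n r (suc r))) ⟩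
      (r + suc r * suc r) * n ^ (r + suc r) ∎
    where open ≤-Reasoning

-- Uniform families of subsets

x∈p─q⇒x∉q : ∀ {n} {p q : Subset n} {x} → x ∈ p ─ q → x ∉ q
x∈p─q⇒x∉q {p = _ ∷ p} {outside ∷ q} here        ()
x∈p─q⇒x∉q {p = _ ∷ p} {outside ∷ q} (there x∈) (there x∈q) = x∈p─q⇒x∉q x∈ x∈q
x∈p─q⇒x∉q {p = _ ∷ p} {inside  ∷ q} (there x∈) (there x∈q) = x∈p─q⇒x∉q x∈ x∈q

x∉p-x : ∀ {n} {p : Subset n} x → x ∉ p - x
x∉p-x x x∈ = x∈p─q⇒x∉q x∈ (x∈⁅x⁆ x)

∈p-x⇒≢ : ∀ {n} {p : Subset n} {x y} → y ∈ p - x → y ≢ x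
∈p-x⇒≢ {x = x} y∈ refl = x∉p-x x y∈

∈p-x⇒∈p : ∀ {n} {p : Subset n} {x y} → y ∈ p - x → y ∈ p
∈p-x⇒∈p {p = p} {x} = p─q⊆p p ⁅ x ⁆

∣p-x∣ : ∀ {n} {p : Subset n} {x} → x ∈ p → suc ∣ p - x ∣ ≡ ∣ p ∣
∣p-x∣ {p = inside  ∷ p} here        = cong (suc ∘ ∣_∣) (p─⊥≡p p)
∣p-x∣ {p = inside  ∷ p} (there x∈p) = cong suc (∣p-x∣ x∈p)
∣p-x∣ {p = outside ∷ p} (there x∈p) = ∣p-x∣ x∈p

p-x≡q-x⇒p≡q : ∀ {n} {p q : Subset n} {x} → x ∈ p → x ∈ q → p - x ≡ q - x → p ≡ q
p-x≡q-x⇒p≡q x∈p x∈q eq = ⊆-antisym (⊆-from x∈q eq) (⊆-from x∈p (sym eq))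
  where
  ⊆-from : ∀ {p q x} → x ∈ q → p - x ≡ q - x → p ⊆ q
  ⊆-from {q = q} {x} x∈q eq {y} y∈p with y ≟ x
  ... | yes refl = x∈q
  ... | no  y≢x  = p─q⊆p q ⁅ x ⁆ (subst (y ∈_) eq (x∈p∧x≢y⇒x∈p-y y∈p y≢x))

record Enumeration {n} (p : Subset n) (r : ℕ) : Set where
  field
    point           : Fin r → Fin n
    point-injective : Injective _≡_ _≡_ point
    point∈          : ∀ t → point t ∈ p
    point-onto      : ∀ {x} → x ∈ p → ∃[ t ] point t ≡ x

enumerate : ∀ {n} (p : Subset n) → Enumeration p ∣ p ∣
enumerate [] = record { point = λ () ; point-injective = λ { {()} } ; point∈ = λ () ; point-onto = λ () }
enumerate (inside ∷ p) = record
  { point           = lift 1 point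
  ; point-injective = Finₚ.lift-injective point point-injective 1
  ; point∈          = λ { zero → here ; (suc t) → there (point∈ t) }
  ; point-onto      = λ { here → zero , refl ; (there x∈p) → let t , eq = point-onto x∈p in suc t , cong suc eq }
  }
  where open Enumeration (enumerate p)
enumerate (outside ∷ p) = record
  { point           = suc ∘ point
  ; point-injective = point-injective ∘ Finₚ.suc-injective
  ; point∈          = there ∘ point∈
  ; point-onto      = λ { (there x∈p) → let t , eq = point-onto x∈p in t , cong suc eq }
  }
  where open Enumeration (enumerate p)

enumerate-∣∣≡ : ∀ {n r} (p : Subset n) → ∣ p ∣ ≡ r → Enumeration p r
enumerate-∣∣≡ p refl = enumerate p

length-filter-partition : ∀ {A : Set} {P : Pred A 0ℓ} (P? : Decidable P) xs →
                          length xs ≡ length (filter P? xs) + length (filter (¬? ∘ P?) xs)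
length-filter-partition P? []       = refl
length-filter-partition P? (x ∷ xs) with P? x
... | yes _ = cong suc (length-filter-partition P? xs)
... | no  _ = trans (cong suc (length-filter-partition P? xs)) (sym (+-suc _ _))

length-filter-∷ : ∀ {A : Set} {P : Pred A 0ℓ} (P? : Decidable P) x xs →
                  length (filter P? (x ∷ xs)) ≡ 𝟙 (does (P? x)) + length (filter P? xs)
length-filter-∷ P? x xs with P? x
... | yes _ = refl
... | no  _ = refl

Unique-map⁺ : ∀ {A B : Set} {P : Pred A 0ℓ} {f : A → B} →
              (∀ {x y} → P x → P y → f x ≡ f y → x ≡ y) →
              ∀ {xs} → All P xs → Unique xs → Unique (map f xs)
Unique-map⁺ inj []         []           = []
Unique-map⁺ inj (px ∷ pxs) (x∉xs ∷ !xs) =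
  All.map⁺ (All.zipWith (λ (py , x≢y) fx≡fy → x≢y (inj px py fx≡fy)) (pxs , x∉xs)) ∷ Unique-map⁺ inj pxs !xs

-- Split by the first coordinate: the members containing 0 and those avoiding it.
uniform-family-bound : ∀ n r (L : List (Subset n)) → Unique L → All (λ e → ∣ e ∣ ≡ r) L → length L ≤ n ^ r
uniform-family-bound zero _ []            _               _          = z≤n
uniform-family-bound zero _ ([] ∷ [])     _               (refl ∷ _) = ≤-refl
uniform-family-bound zero _ ([] ∷ [] ∷ _) ((≢[] ∷ _) ∷ _) _          = ⊥-elim (≢[] refl)
uniform-family-bound (suc n) r L !L sizes = begin
    length L
  ≡⟨ length-filter-partition first? L ⟩
    length With + length Without
  ≡⟨ sym (cong₂ _+_ (length-map tail With) (length-map tail Without)) ⟩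
    length (map tail With) + length (map tail Without)
  ≤⟨ split-bound r sizesWith sizesWithout ⟩
    suc n ^ r ∎
  where
  open ≤-Reasoning
  First : Pred (Subset (suc n)) 0ℓ
  First e = head e ≡ inside
  first? : Decidable First
  first? e = head e Bool.≟ inside
  With Without : List (Subset (suc n))
  With    = filter first? L
  Without = filter (¬? ∘ first?) L

  ∷-≡ : ∀ {e e′ : Subset (suc n)} → head e ≡ head e′ → tail e ≡ tail e′ → e ≡ e′
  ∷-≡ {_ ∷ _} {_ ∷ _} refl refl = refl

  !With : Unique (map tail With)
  !With = Unique-map⁺ (λ f f′ → ∷-≡ (trans f (sym f′)))
            (All.all-filter first? L) (Unique.filter⁺ first? !L)
  !Without : Unique (map tail Without)
  !Without = Unique-map⁺ (λ f f′ → ∷-≡ (trans (¬-not f) (sym (¬-not f′))))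
               (All.all-filter (¬? ∘ first?) L) (Unique.filter⁺ (¬? ∘ first?) !L)

  sizesWith : All (λ e → First e × ∣ e ∣ ≡ r) With
  sizesWith = All.zip (All.all-filter first? L , All.filter⁺ first? sizes)
  sizesWithout : All (λ e → ∣ tail e ∣ ≡ r) Without
  sizesWithout = All.zipWith (λ { {outside ∷ _} (_ , eq) → eq ; {inside ∷ _} (¬f , _) → ⊥-elim (¬f refl) })
                   (All.all-filter (¬? ∘ first?) L , All.filter⁺ (¬? ∘ first?) sizes)

  split-bound : ∀ r → All (λ e → First e × ∣ e ∣ ≡ r) With → All (λ e → ∣ tail e ∣ ≡ r) Without →
                length (map tail With) + length (map tail Without) ≤ suc n ^ r
  split-bound zero sW sW′ = begin
      length (map tail With) + length (map tail Without)
    ≡⟨ cong (_+ length (map tail Without)) (trans (length-map tail With) (empty sW)) ⟩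
      length (map tail Without)
    ≤⟨ uniform-family-bound n 0 (map tail Without) !Without (All.map⁺ sW′) ⟩
      1 ∎
    where
    empty : ∀ {xs} → All (λ e → First e × ∣ e ∣ ≡ 0) xs → length xs ≡ 0
    empty []                            = refl
    empty (_∷_ {x = inside ∷ _} (_ , ()) _)
    empty (_∷_ {x = outside ∷ _} (() , _) _)
  split-bound (suc r) sW sW′ = begin
      length (map tail With) + length (map tail Without)
    ≤⟨ +-mono-≤ (uniform-family-bound n r (map tail With) !With (All.map⁺ (All.map (λ {e} → tail-size {e}) sW)))
                (uniform-family-bound n (suc r) (map tail Without) !Without (All.map⁺ sW′)) ⟩
      n ^ r + n * n ^ r
    ≤⟨ *-monoʳ-≤ (suc n) (^-monoˡ-≤ r (n≤1+n n)) ⟩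
      suc n * suc n ^ r ∎
    where
    tail-size : ∀ {e} → First e × ∣ e ∣ ≡ suc r → ∣ tail e ∣ ≡ r
    tail-size {inside ∷ _} (_ , eq) = suc-injective eq

-- n ^ (r ∸ j) for j ≤ r, but 0 for j > r, since no r-set has j > r distinct points.
supersetBound : ℕ → ℕ → ℕ → ℕ
supersetBound n r       zero    = n ^ r
supersetBound n zero    (suc j) = 0
supersetBound n (suc r) (suc j) = supersetBound n r j

*-supersetBound-suc : ∀ n r j → n * supersetBound n r (suc j) ≤ supersetBound n r j
*-supersetBound-suc n zero    j       = ≤-trans (≤-reflexive (*-zeroʳ n)) z≤n
*-supersetBound-suc n (suc r) zero    = ≤-refl
*-supersetBound-suc n (suc r) (suc j) = *-supersetBound-suc n r j

-- Delete the given points one at a time.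
superset-family-bound : ∀ {n} r (xs : List (Fin n)) → Unique xs → (L : List (Subset n)) → Unique L →
                        All (λ e → ∣ e ∣ ≡ r × All (_∈ e) xs) L → length L ≤ supersetBound n r (length xs)
superset-family-bound {n} r [] _ L !L members = uniform-family-bound n r L !L (All.map proj₁ members)
superset-family-bound r       (x ∷ xs) _ [] _ _ = z≤n
superset-family-bound zero    (x ∷ xs) _ (e ∷ L) _ ((size , x∈e ∷ _) ∷ _) =
  ⊥-elim (0≢1+n (trans (sym size) (sym (∣p-x∣ x∈e))))
superset-family-bound (suc r) (x ∷ xs) (x∉xs ∷ !xs) L !L members = begin
    length L
  ≡⟨ sym (length-map (_- x) L) ⟩
    length (map (_- x) L)
  ≤⟨ superset-family-bound r xs !xs (map (_- x) L)
       (Unique-map⁺ p-x≡q-x⇒p≡q (All.map (λ { (_ , x∈e ∷ _) → x∈e }) members) !L)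
       (All.map⁺ (All.map shrink members)) ⟩
    supersetBound _ r (length xs) ∎
  where
  open ≤-Reasoning
  shrink : ∀ {e} → ∣ e ∣ ≡ suc r × All (_∈ e) (x ∷ xs) → ∣ e - x ∣ ≡ r × All (_∈ e - x) xs
  shrink (size , x∈e ∷ xs⊆e) =
    suc-injective (trans (∣p-x∣ x∈e) size) ,
    All.zipWith (λ (y∈e , x≢y) → x∈p∧x≢y⇒x∈p-y y∈e (x≢y ∘ sym)) (xs⊆e , x∉xs)

-- Codegrees

PairIn : ∀ {n} → Fin n → Fin n → Pred (Subset n) 0ℓ
PairIn u v e = u ≢ v × u ∈ e × v ∈ e

pairIn? : ∀ {n} (u v : Fin n) → Decidable (PairIn u v)
pairIn? u v e = ¬? (u ≟ v) ×-dec u ∈? e ×-dec v ∈? e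

pairIn-∣∣≡2+ : ∀ {n k′} {e : Subset n} → ∣ e ∣ ≡ 2 + k′ → ∃[ u ] ∃[ v ] PairIn u v e
pairIn-∣∣≡2+ {e = e} size =
  point zero , point (suc zero) , Finₚ.0≢1+n ∘ point-injective , point∈ zero , point∈ (suc zero)
  where open Enumeration (enumerate-∣∣≡ e size)

codegree : ∀ {n} → List (Subset n) → Fin n → Fin n → ℕ
codegree E u v = length (filter (pairIn? u v) E)

codegree-diag : ∀ {n} (E : List (Subset n)) u → codegree E u u ≡ 0
codegree-diag E u = cong length (filter-none (pairIn? u u) {E} (All.tabulate (λ _ (u≢u , _) → u≢u refl)))

codegree>0⇒≢ : ∀ {n} (E : List (Subset n)) {u v} → 0 < codegree E u v → u ≢ v
codegree>0⇒≢ E {u} pos refl = <-irrefl (sym (codegree-diag E u)) pos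

codegree≤ : ∀ {n} r (E : List (Subset n)) → Unique E → All (λ e → ∣ e ∣ ≡ r) E →
            ∀ u v → codegree E u v ≤ supersetBound n r 2
codegree≤ {n} r E !E uniform u v = bound (u ≟ v)
  where
  bound : Dec (u ≡ v) → codegree E u v ≤ supersetBound n r 2
  bound (yes refl) = ≤-trans (≤-reflexive (codegree-diag E u)) z≤n
  bound (no u≢v)   = superset-family-bound r (u ∷ v ∷ []) ((u≢v ∷ []) ∷ [] ∷ [])
    (filter (pairIn? u v) E) (Unique.filter⁺ _ !E)
    (All.zipWith (λ (size , _ , u∈e , v∈e) → size , u∈e ∷ v∈e ∷ [])
      (All.filter⁺ _ uniform , All.all-filter (pairIn? u v) E))

length≤∑∑pairs : ∀ {n} (L : List (Subset n)) → All (λ e → ∃[ u ] ∃[ v ] PairIn u v e) L →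
                 length L ≤ ∑[ u < n ] ∑[ v < n ] length (filter (pairIn? u v) L)
length≤∑∑pairs         []      []                          = z≤n
length≤∑∑pairs {n} (e ∷ L) ((u , v , uv∈e) ∷ pairs) = begin
    suc (length L)
  ≤⟨ +-mono-≤ (≤-trans (≤-reflexive (cong 𝟙 (sym (dec-true (pairIn? u v e) uv∈e))))
                       (≤-trans (≤-∑ (λ v → 𝟙 (does (pairIn? u v e))) v)
                                (≤-∑ (λ u → ∑[ v < n ] 𝟙 (does (pairIn? u v e))) u)))
              (length≤∑∑pairs L pairs) ⟩
    ∑[ u < n ] ∑[ v < n ] 𝟙 (does (pairIn? u v e)) + ∑[ u < n ] ∑[ v < n ] length (filter (pairIn? u v) L)
  ≡⟨ sym (trans (sum-cong-≗ {n} (λ u → trans (sum-cong-≗ {n} (λ v → length-filter-∷ (pairIn? u v) e L))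
                                             (∑-distrib-+ (λ v → 𝟙 (does (pairIn? u v e))) _)))
                (∑-distrib-+ (λ u → ∑[ v < n ] 𝟙 (does (pairIn? u v e))) _)) ⟩
    ∑[ u < n ] ∑[ v < n ] length (filter (pairIn? u v) (e ∷ L)) ∎
  where open ≤-Reasoning

ThirdPoint : ∀ {n} → Fin n → Fin n → Fin n → Pred (Subset n) 0ℓ
ThirdPoint u v y e = y ≢ u × y ≢ v × y ∈ e

thirdPoint? : ∀ {n} (u v y : Fin n) → Decidable (ThirdPoint u v y)
thirdPoint? u v y e = ¬? (y ≟ u) ×-dec ¬? (y ≟ v) ×-dec y ∈? e

avoiding : ∀ {n} → Fin n → Fin n → List (Fin n) → List (Subset n) → List (Subset n)
avoiding u v []      T = T
avoiding u v (y ∷ F) T = filter (¬? ∘ thirdPoint? u v y) (avoiding u v F T)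

module _ {n} {u v : Fin n} where

  avoiding-All : ∀ {P : Pred (Subset n) 0ℓ} F {T} → All P T → All P (avoiding u v F T)
  avoiding-All []      = λ pT → pT
  avoiding-All (y ∷ F) = All.filter⁺ (¬? ∘ thirdPoint? u v y) ∘ avoiding-All F

  avoiding-Unique : ∀ F {T} → Unique T → Unique (avoiding u v F T)
  avoiding-Unique []      = λ !T → !T
  avoiding-Unique (y ∷ F) = Unique.filter⁺ (¬? ∘ thirdPoint? u v y) ∘ avoiding-Unique F

  avoiding-sound : ∀ F {T e} → e ∈ₗ avoiding u v F T → e ∈ₗ T × All (λ y → ¬ ThirdPoint u v y e) F
  avoiding-sound []      e∈ = e∈ , []
  avoiding-sound (y ∷ F) e∈ with ∈-filter⁻ (¬? ∘ thirdPoint? u v y) e∈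
  ... | e∈′ , ¬third with avoiding-sound F e∈′
  ...   | e∈T , avoidsF = e∈T , ¬third ∷ avoidsF

  -- Each point y of F kills at most supersetBound n r 3 members: those containing u, v and y.
  avoiding-bound : ∀ r → u ≢ v → ∀ F T → Unique T → All (λ e → ∣ e ∣ ≡ r × PairIn u v e) T →
                   length T ≤ length F * supersetBound n r 3 + length (avoiding u v F T)
  avoiding-bound r u≢v []      T !T members = ≤-refl
  avoiding-bound r u≢v (y ∷ F) T !T members = begin
      length T
    ≤⟨ avoiding-bound r u≢v F T !T members ⟩
      length F * B + length A
    ≡⟨ cong (length F * B +_) (length-filter-partition (thirdPoint? u v y) A) ⟩
      length F * B + (length (filter (thirdPoint? u v y) A) + length (avoiding u v (y ∷ F) T))
    ≤⟨ +-monoʳ-≤ (length F * B) (+-monoˡ-≤ _ killed≤B) ⟩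
      length F * B + (B + length (avoiding u v (y ∷ F) T))
    ≡⟨ trans (sym (+-assoc (length F * B) B _)) (cong (_+ length (avoiding u v (y ∷ F) T)) (+-comm (length F * B) B)) ⟩
      suc (length F) * B + length (avoiding u v (y ∷ F) T) ∎
    where
    open ≤-Reasoning
    B : ℕ
    B = supersetBound n r 3
    A : List (Subset n)
    A = avoiding u v F T
    killed≤B : length (filter (thirdPoint? u v y) A) ≤ B
    killed≤B = killed-bound (y ≟ u) (y ≟ v)
      where
      none : (∀ {e} → ¬ ThirdPoint u v y e) → length (filter (thirdPoint? u v y) A) ≤ B
      none ¬third =
        subst (_≤ B) (sym (cong length (filter-none (thirdPoint? u v y) {A} (All.tabulate (λ _ → ¬third))))) z≤n
      killed-bound : Dec (y ≡ u) → Dec (y ≡ v) → length (filter (thirdPoint? u v y) A) ≤ B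
      killed-bound (yes y≡u) _         = none (λ (y≢u , _) → y≢u y≡u)
      killed-bound (no _)    (yes y≡v) = none (λ (_ , y≢v , _) → y≢v y≡v)
      killed-bound (no y≢u)  (no y≢v)  = superset-family-bound r (u ∷ v ∷ y ∷ [])
        ((u≢v ∷ (y≢u ∘ sym) ∷ []) ∷ ((y≢v ∘ sym) ∷ []) ∷ [] ∷ [])
        (filter (thirdPoint? u v y) A) (Unique.filter⁺ _ (avoiding-Unique F !T))
        (All.zipWith (λ ((size , _ , u∈e , v∈e) , (_ , _ , y∈e)) → size , u∈e ∷ v∈e ∷ y∈e ∷ [])
          (All.filter⁺ _ (avoiding-All F members) , All.all-filter (thirdPoint? u v y) A))

  avoiding-member : ∀ r → u ≢ v → ∀ F T → Unique T → All (λ e → ∣ e ∣ ≡ r × PairIn u v e) T →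
                    length F * supersetBound n r 3 < length T →
                    ∃[ e ] e ∈ₗ T × All (λ y → ¬ ThirdPoint u v y e) F
  avoiding-member r u≢v F T !T members F-small with avoiding u v F T in eq
  ... | e ∷ _ = e , avoiding-sound F (subst (e ∈ₗ_) (sym eq) (hereₗ refl))
  ... | []    = ⊥-elim (<⇒≱ F-small (begin
      length T                                                ≤⟨ avoiding-bound r u≢v F T !T members ⟩
      length F * supersetBound n r 3 + length (avoiding u v F T) ≡⟨ cong (λ A → _ + length A) eq ⟩
      length F * supersetBound n r 3 + 0                      ≡⟨ +-identityʳ _ ⟩
      length F * supersetBound n r 3                          ∎))
    where open ≤-Reasoning

-- Embedding the hedgehog

module _ {P X : Set} {C : P → Set} {t : ℕ} (foot : ∀ {p} → C p → Fin t → X) where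

  Choices : List P → Set
  Choices ps = ∀ {p} → p ∈ₗ ps → C p

  feet : ∀ ps → Choices ps → List X
  feet []       σ = []
  feet (q ∷ ps) σ = tabulate (foot (σ (hereₗ refl))) ++ feet ps (λ p∈ → σ (thereₗ p∈))

  length-feet : ∀ ps (σ : Choices ps) → length (feet ps σ) ≡ length ps * t
  length-feet []       σ = refl
  length-feet (q ∷ ps) σ = trans (length-++ (tabulate (foot (σ (hereₗ refl)))))
    (cong₂ _+_ (length-tabulate (foot (σ (hereₗ refl)))) (length-feet ps (λ p∈ → σ (thereₗ p∈))))

  ∈-feet : ∀ ps (σ : Choices ps) {p} (p∈ : p ∈ₗ ps) i → foot (σ p∈) i ∈ₗ feet ps σ
  ∈-feet (q ∷ ps) σ (hereₗ refl) i = ∈-++⁺ˡ (∈-tabulate⁺ i)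
  ∈-feet (q ∷ ps) σ (thereₗ p∈)  i = ∈-++⁺ʳ _ (∈-feet ps (λ p∈ → σ (thereₗ p∈)) p∈ i)

  record DisjointChoices (base : List X) (ps : List P) : Set where
    field
      choice      : Choices ps
      avoids-base : ∀ {p} (p∈ : p ∈ₗ ps) i → foot (choice p∈) i ∉ₗ base
      disjoint    : ∀ {p q} (p∈ : p ∈ₗ ps) (q∈ : q ∈ₗ ps) → p ≢ q →
                    ∀ i j → foot (choice p∈) i ≢ foot (choice q∈) j

  -- Choose for one index after another, each time avoiding the base and all earlier feet.
  greedy-disjoint : ∀ s (base : List X) ps → length base + length ps * t ≤ s →
    (∀ p (F : List X) → length F ≤ s → Σ (C p) λ c → ∀ i → foot c i ∉ₗ F) →
    DisjointChoices base ps
  greedy-disjoint s base []       _      choose = record { choice = λ () ; avoids-base = λ () ; disjoint = λ () }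
  greedy-disjoint s base (p ∷ ps) budget choose =
    record { choice = σ ; avoids-base = avoids-base ; disjoint = disjoint }
    where
    earlier : DisjointChoices base ps
    earlier = greedy-disjoint s base ps (≤-trans (+-monoʳ-≤ (length base) (m≤n+m _ t)) budget) choose
    module Earlier = DisjointChoices earlier
    F : List X
    F = base ++ feet ps Earlier.choice
    F≤s : length F ≤ s
    F≤s = ≤-trans (≤-reflexive (trans (length-++ base) (cong (length base +_) (length-feet ps Earlier.choice))))
                  (≤-trans (+-monoʳ-≤ (length base) (m≤n+m _ t)) budget)
    new : Σ (C p) λ c → ∀ i → foot c i ∉ₗ F
    new = choose p F F≤s
    σ : Choices (p ∷ ps)
    σ (hereₗ refl) = proj₁ new
    σ (thereₗ q∈)  = Earlier.choice q∈
    avoids-base : ∀ {q} (q∈ : q ∈ₗ p ∷ ps) i → foot (σ q∈) i ∉ₗ base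
    avoids-base (hereₗ refl) i = proj₂ new i ∘ ∈-++⁺ˡ
    avoids-base (thereₗ q∈)  i = Earlier.avoids-base q∈ i
    disjoint : ∀ {q q′} (q∈ : q ∈ₗ p ∷ ps) (q′∈ : q′ ∈ₗ p ∷ ps) → q ≢ q′ →
               ∀ i j → foot (σ q∈) i ≢ foot (σ q′∈) j
    disjoint (hereₗ refl) (hereₗ refl) q≢q′ = ⊥-elim (q≢q′ refl)
    disjoint (hereₗ refl) (thereₗ q′∈) _ i j eq =
      proj₂ new i (subst (_∈ₗ F) (sym eq) (∈-++⁺ʳ base (∈-feet ps Earlier.choice q′∈ j)))
    disjoint (thereₗ q∈) (hereₗ refl) _ i j eq =
      proj₂ new j (subst (_∈ₗ F) eq (∈-++⁺ʳ base (∈-feet ps Earlier.choice q∈ i)))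
    disjoint (thereₗ q∈) (thereₗ q′∈) = Earlier.disjoint q∈ q′∈

-- The spines of a host edge through a i and b j are its k - 2 other points.
module HedgehogEmbedding {n k′ d : ℕ} (E : List (Subset n)) (!E : Unique E)
         (uniform : All (λ e → ∣ e ∣ ≡ 2 + k′) E)
         (a b : Fin d → Fin n) (a-injective : Injective _≡_ _≡_ a) (b-injective : Injective _≡_ _≡_ b)
         (heavy : ∀ i j → (d + d + d * d * k′) * supersetBound n (2 + k′) 3 < codegree E (a i) (b j)) where

  record EdgeThrough (ij : Fin d × Fin d) : Set where
    field
      edge            : Subset n
      edge∈E          : edge ∈ₗ E
      pair∈edge       : PairIn (a (proj₁ ij)) (b (proj₂ ij)) edge
      spine           : Fin k′ → Fin n
      spine-injective : Injective _≡_ _≡_ spine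
      spine∈edge      : ∀ t → spine t ∈ edge
      edge⊆           : ∀ {x} → x ∈ edge → x ≡ a (proj₁ ij) ⊎ x ≡ b (proj₂ ij) ⊎ ∃[ t ] spine t ≡ x
  open EdgeThrough

  base : List (Fin n)
  base = tabulate a ++ tabulate b

  length-base : length base ≡ d + d
  length-base = trans (length-++ (tabulate a)) (cong₂ _+_ (length-tabulate a) (length-tabulate b))

  choose : ∀ ij (F : List (Fin n)) → length F ≤ d + d + d * d * k′ →
           Σ (EdgeThrough ij) λ c → ∀ t → spine c t ∉ₗ F
  choose (i , j) F F≤s = build (avoiding-member (2 + k′) u≢v F T (Unique.filter⁺ _ !E)
                                  (All.zip (All.filter⁺ _ uniform , All.all-filter (pairIn? u v) E))
                                  (≤-trans (s≤s (*-monoˡ-≤ _ F≤s)) (heavy i j)))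
    where
    u v : Fin n
    u = a i
    v = b j
    T : List (Subset n)
    T = filter (pairIn? u v) E
    u≢v : u ≢ v
    u≢v = codegree>0⇒≢ E (≤-trans (s≤s z≤n) (heavy i j))
    build : ∃[ e ] e ∈ₗ T × All (λ y → ¬ ThirdPoint u v y e) F →
            Σ (EdgeThrough (i , j)) λ c → ∀ t → spine c t ∉ₗ F
    build (e , e∈T , avoidsF) = record
      { edge = e ; edge∈E = e∈E ; pair∈edge = pair
      ; spine = point ; spine-injective = point-injective ; spine∈edge = spine∈e ; edge⊆ = e⊆ }
      , λ t p∈F → All.lookup avoidsF p∈F (spine≢u t , spine≢v t , spine∈e t)
      where
      e∈E : e ∈ₗ E
      e∈E = proj₁ (∈-filter⁻ (pairIn? u v) {xs = E} e∈T)
      pair : PairIn u v e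
      pair = proj₂ (∈-filter⁻ (pairIn? u v) {xs = E} e∈T)
      u∈e : u ∈ e
      u∈e = proj₁ (proj₂ pair)
      v∈e-u : v ∈ e - u
      v∈e-u = x∈p∧x≢y⇒x∈p-y (proj₂ (proj₂ pair)) (u≢v ∘ sym)
      size : ∣ e - u - v ∣ ≡ k′
      size = suc-injective (suc-injective (begin
        suc (suc ∣ e - u - v ∣) ≡⟨ cong suc (∣p-x∣ v∈e-u) ⟩
        suc ∣ e - u ∣           ≡⟨ ∣p-x∣ u∈e ⟩
        ∣ e ∣                   ≡⟨ All.lookup uniform e∈E ⟩
        2 + k′                  ∎))
        where open ≡-Reasoning
      open Enumeration (enumerate-∣∣≡ (e - u - v) size)
      spine∈e : ∀ t → point t ∈ e
      spine∈e t = ∈p-x⇒∈p (∈p-x⇒∈p (point∈ t))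
      spine≢u : ∀ t → point t ≢ u
      spine≢u t = ∈p-x⇒≢ (∈p-x⇒∈p (point∈ t))
      spine≢v : ∀ t → point t ≢ v
      spine≢v t = ∈p-x⇒≢ (point∈ t)
      e⊆ : ∀ {x} → x ∈ e → x ≡ u ⊎ x ≡ v ⊎ ∃[ t ] point t ≡ x
      e⊆ {x} x∈e with x ≟ u | x ≟ v
      ... | yes x≡u | _       = inj₁ x≡u
      ... | no _    | yes x≡v = inj₂ (inj₁ x≡v)
      ... | no x≢u  | no x≢v  = inj₂ (inj₂ (point-onto (x∈p∧x≢y⇒x∈p-y (x∈p∧x≢y⇒x∈p-y x∈e x≢u) x≢v)))

  allPairs : List (Fin d × Fin d)
  allPairs = tabulate (remQuot {d} d)

  ∈-allPairs : ∀ i j → (i , j) ∈ₗ allPairs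
  ∈-allPairs i j = subst (_∈ₗ allPairs) (Finₚ.remQuot-combine i j) (∈-tabulate⁺ (combine i j))

  chosen : DisjointChoices spine base allPairs
  chosen = greedy-disjoint spine (d + d + d * d * k′) base allPairs
             (≤-reflexive (cong₂ (λ x y → x + y * k′) length-base (length-tabulate (remQuot {d} d))))
             choose

  open DisjointChoices chosen

  edgeAt : ∀ i j → EdgeThrough (i , j)
  edgeAt i j = choice (∈-allPairs i j)

  a≢b : ∀ i j → a i ≢ b j
  a≢b i j = proj₁ (pair∈edge (edgeAt i j))

  spine≢a : ∀ i j t i′ → spine (edgeAt i j) t ≢ a i′
  spine≢a i j t i′ eq = avoids-base (∈-allPairs i j) t
    (subst (_∈ₗ base) (sym eq) (∈-++⁺ˡ (∈-tabulate⁺ i′)))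

  spine≢b : ∀ i j t j′ → spine (edgeAt i j) t ≢ b j′
  spine≢b i j t j′ eq = avoids-base (∈-allPairs i j) t
    (subst (_∈ₗ base) (sym eq) (∈-++⁺ʳ (tabulate a) (∈-tabulate⁺ j′)))

  spines-disjoint : ∀ {i j i′ j′} → (i , j) ≢ (i′ , j′) →
                    ∀ t t′ → spine (edgeAt i j) t ≢ spine (edgeAt i′ j′) t′
  spines-disjoint {i} {j} {i′} {j′} = disjoint (∈-allPairs i j) (∈-allPairs i′ j′)

  embed : HedgehogVertex d (2 + k′) → Fin n
  embed (inj₁ i)                  = a i
  embed (inj₂ (inj₁ j))           = b j
  embed (inj₂ (inj₂ (t , i , j))) = spine (edgeAt i j) t

  embed-injective : Injective _≡_ _≡_ embed
  embed-injective {inj₁ i}                  {inj₁ i′}                    eq = cong inj₁ (a-injective eq)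
  embed-injective {inj₁ i}                  {inj₂ (inj₁ j′)}             eq = ⊥-elim (a≢b i j′ eq)
  embed-injective {inj₁ i}                  {inj₂ (inj₂ (t′ , i′ , j′))} eq = ⊥-elim (spine≢a i′ j′ t′ i (sym eq))
  embed-injective {inj₂ (inj₁ j)}           {inj₁ i′}                    eq = ⊥-elim (a≢b i′ j (sym eq))
  embed-injective {inj₂ (inj₁ j)}           {inj₂ (inj₁ j′)}             eq = cong (inj₂ ∘ inj₁) (b-injective eq)
  embed-injective {inj₂ (inj₁ j)}           {inj₂ (inj₂ (t′ , i′ , j′))} eq = ⊥-elim (spine≢b i′ j′ t′ j (sym eq))
  embed-injective {inj₂ (inj₂ (t , i , j))} {inj₁ i′}                    eq = ⊥-elim (spine≢a i j t i′ eq)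
  embed-injective {inj₂ (inj₂ (t , i , j))} {inj₂ (inj₁ j′)}             eq = ⊥-elim (spine≢b i j t j′ eq)
  embed-injective {inj₂ (inj₂ (t , i , j))} {inj₂ (inj₂ (t′ , i′ , j′))} eq with i ≟ i′ | j ≟ j′
  ... | yes refl | yes refl = cong (λ t → inj₂ (inj₂ (t , i , j))) (spine-injective (edgeAt i j) eq)
  ... | no i≢i′  | _        = ⊥-elim (spines-disjoint (i≢i′ ∘ cong proj₁) t t′ eq)
  ... | yes _    | no j≢j′  = ⊥-elim (spines-disjoint (j≢j′ ∘ cong proj₂) t t′ eq)

  contains : Contains n E (Hedgehog d (2 + k′))
  contains = embed , embed-injective ,
    λ (i , j) → edge (edgeAt i j) , edge∈E (edgeAt i j) , λ x → mk⇔ (to i j) (from i j)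
    where
    to : ∀ i j {x} → x ∈ edge (edgeAt i j) → ∃[ w ] (HedgehogMember d (2 + k′) w (i , j) × embed w ≡ x)
    to i j x∈ with edge⊆ (edgeAt i j) x∈
    ... | inj₁ x≡a               = inj₁ i , first i j , sym x≡a
    ... | inj₂ (inj₁ x≡b)        = inj₂ (inj₁ j) , second i j , sym x≡b
    ... | inj₂ (inj₂ (t , t↦x))  = inj₂ (inj₂ (t , i , j)) , extra t i j , t↦x
    from : ∀ i j {x} → ∃[ w ] (HedgehogMember d (2 + k′) w (i , j) × embed w ≡ x) → x ∈ edge (edgeAt i j)
    from i j (_ , first .i .j   , refl) = proj₁ (proj₂ (pair∈edge (edgeAt i j)))
    from i j (_ , second .i .j  , refl) = proj₂ (proj₂ (pair∈edge (edgeAt i j)))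
    from i j (_ , extra t .i .j , refl) = spine∈edge (edgeAt i j) t

-- The extremal bound

module HedgehogExtremal (r k′ : ℕ) where

  d k s C : ℕ
  d = suc r
  k = 2 + k′
  s = d + d + d * d * k′
  C = 2 ^ d * (s ^ d + (r + d * d))

  module _ {n : ℕ} .{{_ : NonZero n}} (E : List (Subset n)) (!E : Unique E)
           (uniform : All (λ e → ∣ e ∣ ≡ k) E) (hedgehog-free : ¬ Contains n E (Hedgehog d k)) where

    B : ℕ
    B = supersetBound n k 3

    heavy? : ∀ u v → Dec (s * B < codegree E u v)
    heavy? u v = s * B <? codegree E u v

    open KőváriSósTurán (λ u v → does (heavy? u v))

    no-heavy-biclique : ¬ HasBiclique d
    no-heavy-biclique (a , b , a-inj , b-inj , a~b) = hedgehog-free (HedgehogEmbedding.contains E !E uniform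
      a b a-inj b-inj (λ i j → does≡true⇒ (heavy? (a i) (b j)) (a~b i j)))

    D X : ℕ
    D = ∑[ u < n ] degree u
    -- definitionally equal to k * d ∸ 1
    X = r + suc k′ * d

    codegree-split : ∀ u v → codegree E u v ≤ s * B + 𝟙 (does (heavy? u v)) * n ^ k′
    codegree-split u v = split (heavy? u v)
      where
      split : (h : Dec (s * B < codegree E u v)) → codegree E u v ≤ s * B + 𝟙 (does h) * n ^ k′
      split (yes _)     = ≤-trans (codegree≤ k E !E uniform u v)
                                  (≤-trans (≤-reflexive (sym (+-identityʳ (n ^ k′)))) (m≤n+m _ (s * B)))
      split (no  light) = ≤-trans (≮⇒≥ light) (m≤m+n (s * B) 0)

    edges≤ : length E ≤ n * (n * (s * B)) + D * n ^ k′
    edges≤ = begin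
        length E
      ≤⟨ length≤∑∑pairs E (All.map pairIn-∣∣≡2+ uniform) ⟩
        ∑[ u < n ] ∑[ v < n ] codegree E u v
      ≤⟨ ∑-mono-≤ (λ u → ∑-mono-≤ (codegree-split u)) ⟩
        ∑[ u < n ] ∑[ v < n ] (s * B + 𝟙 (does (heavy? u v)) * n ^ k′)
      ≡⟨ sum-cong-≗ {n} row ⟩
        ∑[ u < n ] (n * (s * B) + degree u * n ^ k′)
      ≡⟨ trans (∑-distrib-+ (λ _ → n * (s * B)) (λ u → degree u * n ^ k′))
               (cong₂ _+_ (∑-const n (n * (s * B))) (sym (*-distribʳ-sum (n ^ k′) degree))) ⟩
        n * (n * (s * B)) + D * n ^ k′ ∎
      where
      open ≤-Reasoning
      row : ∀ u → ∑[ v < n ] (s * B + 𝟙 (does (heavy? u v)) * n ^ k′) ≡ n * (s * B) + degree u * n ^ k′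
      row u = trans (∑-distrib-+ (λ _ → s * B) (λ v → 𝟙 (does (heavy? u v)) * n ^ k′))
                    (cong₂ _+_ (∑-const n (s * B)) (sym (*-distribʳ-sum (n ^ k′) (λ v → 𝟙 (does (heavy? u v))))))

    light-part : (n * (n * (s * B))) ^ d ≤ s ^ d * n ^ X
    light-part = begin
        (n * (n * (s * B))) ^ d
      ≡⟨ cong (_^ d) (solve 3 (λ n s B → n :* (n :* (s :* B)) := s :* (n :* (n :* B))) refl n s B) ⟩
        (s * (n * (n * B))) ^ d
      ≤⟨ ^-monoˡ-≤ d (*-monoʳ-≤ s (*-monoʳ-≤ n (*-supersetBound-suc n k′ 0))) ⟩
        (s * n ^ suc k′) ^ d
      ≡⟨ trans (^-distribʳ-* s (n ^ suc k′) d) (cong (s ^ d *_) (^-*-assoc n (suc k′) d)) ⟩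
        s ^ d * n ^ (suc k′ * d)
      ≤⟨ *-monoʳ-≤ (s ^ d) (^-monoʳ-≤ n (m≤n+m _ r)) ⟩
        s ^ d * n ^ X ∎
      where open ≤-Reasoning

    heavy-part : (D * n ^ k′) ^ d ≤ (r + d * d) * n ^ X
    heavy-part = begin
        (D * n ^ k′) ^ d
      ≡⟨ trans (^-distribʳ-* D (n ^ k′) d) (cong (D ^ d *_) (^-*-assoc n k′ d)) ⟩
        D ^ d * n ^ (k′ * d)
      ≤⟨ *-monoˡ-≤ (n ^ (k′ * d)) (kővári-sós-turán r no-heavy-biclique) ⟩
        (r + d * d) * n ^ (r + d) * n ^ (k′ * d)
      ≡⟨ *-assoc (r + d * d) _ _ ⟩
        (r + d * d) * (n ^ (r + d) * n ^ (k′ * d))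
      ≡⟨ cong ((r + d * d) *_) (trans (sym (^-distribˡ-+-* n (r + d) (k′ * d))) (cong (n ^_) (+-assoc r d (k′ * d)))) ⟩
        (r + d * d) * n ^ X ∎
      where open ≤-Reasoning

    edges^d≤ : length E ^ d ≤ C * n ^ (k * d ∸ 1)
    edges^d≤ = begin
        length E ^ d
      ≤⟨ ^-monoˡ-≤ d edges≤ ⟩
        (n * (n * (s * B)) + D * n ^ k′) ^ d
      ≤⟨ +-^-≤ (n * (n * (s * B))) (D * n ^ k′) d ⟩
        2 ^ d * ((n * (n * (s * B))) ^ d + (D * n ^ k′) ^ d)
      ≤⟨ *-monoʳ-≤ (2 ^ d) (+-mono-≤ light-part heavy-part) ⟩
        2 ^ d * (s ^ d * n ^ X + (r + d * d) * n ^ X)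
      ≡⟨ solve 4 (λ t a b x → t :* (a :* x :+ b :* x) := t :* (a :+ b) :* x) refl (2 ^ d) (s ^ d) (r + d * d) (n ^ X) ⟩
        C * n ^ X ∎
      where open ≤-Reasoning

  ex-bound : ExBound k d (Hedgehog d k)
  ex-bound = C , λ where
    zero    []        _                 _    → z≤n
    zero    ([] ∷ _)  (_ , () ∷ _)      _
    (suc n) E         (!E , uniform)    free → edges^d≤ E !E uniform free

-- Skeletal degeneracy

injective-through-≤ : ∀ {A : Set} {l m} (g : Fin l → A) → Injective _≡_ _≡_ g →
                      (h : Fin m → A) → (∀ x → ∃[ c ] g x ≡ h c) → l ≤ m
injective-through-≤ g g-inj h through = Finₚ.injective⇒≤ {f = proj₁ ∘ through} λ {x} {y} eq →
  g-inj (trans (proj₂ (through x)) (trans (cong h eq) (sym (proj₂ (through y)))))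

neighbours-through : ∀ {V : Set} {Adj : V → V → Set} {S v m m′} (h : Fin m → V) →
                     (∀ {w} → S w ≡ true → Adj v w → ∃[ c ] w ≡ h c) → m ≤ m′ →
                     ¬ AtLeastNeighbours Adj S v (suc m′)
neighbours-through h through m≤m′ (g , g-inj , g∈) =
  1+n≰n (≤-trans (injective-through-≤ g g-inj h (λ x → through (proj₁ (g∈ x)) (proj₂ (g∈ x)))) m≤m′)

module HedgehogSkeleton (d k′ : ℕ) where

  V : Set
  V = HedgehogVertex d (2 + k′)

  Adj : V → V → Set
  Adj = SkeletonAdj (Hedgehog d (2 + k′))

  edgeVertex : Fin d → Fin d → Fin (2 + k′) → V
  edgeVertex i j zero          = inj₁ i
  edgeVertex i j (suc zero)    = inj₂ (inj₁ j)
  edgeVertex i j (suc (suc t)) = inj₂ (inj₂ (t , i , j))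

  member⇒edgeVertex : ∀ {w i j} → HedgehogMember d (2 + k′) w (i , j) → ∃[ c ] w ≡ edgeVertex i j c
  member⇒edgeVertex (first i j)   = zero , refl
  member⇒edgeVertex (second i j)  = suc zero , refl
  member⇒edgeVertex (extra t i j) = suc (suc t) , refl

  spine-neighbour : ∀ {t i j w} → Adj (inj₂ (inj₂ (t , i , j))) w → ∃[ c ] w ≡ edgeVertex i j c
  spine-neighbour (_ , _ , extra t i j , w∈) = member⇒edgeVertex w∈

  SpineIn : (V → Bool) → Set
  SpineIn S = ∃[ t ] ∃[ i ] ∃[ j ] S (inj₂ (inj₂ (t , i , j))) ≡ true

  spineIn? : ∀ S → Dec (SpineIn S)
  spineIn? S = Finₚ.any? λ t → Finₚ.any? λ i → Finₚ.any? λ j → S (inj₂ (inj₂ (t , i , j))) Bool.≟ true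

  first-neighbour : ∀ {S i w} → ¬ SpineIn S → S w ≡ true → Adj (inj₁ i) w → ∃[ j ] w ≡ inj₂ (inj₁ j)
  first-neighbour noSpine Sw (i≢w , _ , first i j , w∈) with member⇒edgeVertex w∈
  ... | zero          , refl = ⊥-elim (i≢w refl)
  ... | suc zero      , refl = j , refl
  ... | suc (suc t)   , refl = ⊥-elim (noSpine (t , i , j , Sw))

  second-neighbour : ∀ {S j w} → ¬ SpineIn S → S w ≡ true → Adj (inj₂ (inj₁ j)) w → ∃[ i ] w ≡ inj₁ i
  second-neighbour noSpine Sw (j≢w , _ , second i j , w∈) with member⇒edgeVertex w∈
  ... | zero          , refl = i , refl
  ... | suc zero      , refl = ⊥-elim (j≢w refl)
  ... | suc (suc t)   , refl = ⊥-elim (noSpine (t , i , j , Sw))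

  degenerate : 2 + k′ ≤ d → IsDegenerate Adj d
  degenerate k≤d S (w , Sw) = pick (spineIn? S) w Sw
    where
    few : ∀ {v m} (h : Fin m → V) → (∀ {w} → S w ≡ true → Adj v w → ∃[ c ] w ≡ h c) → m ≤ d →
          ¬ AtLeastNeighbours Adj S v (suc d)
    few = neighbours-through {Adj = Adj}
    pick : Dec (SpineIn S) → ∀ w → S w ≡ true → ∃[ v ] (S v ≡ true × ¬ AtLeastNeighbours Adj S v (suc d))
    pick (yes (t , i , j , St)) _ _ =
      inj₂ (inj₂ (t , i , j)) , St , few (edgeVertex i j) (λ _ → spine-neighbour) k≤d
    pick (no noSpine) (inj₁ i) Si =
      inj₁ i , Si , few (inj₂ ∘ inj₁) (first-neighbour {S} noSpine) ≤-refl
    pick (no noSpine) (inj₂ (inj₁ j)) Sj =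
      inj₂ (inj₁ j) , Sj , few inj₁ (second-neighbour {S} noSpine) ≤-refl
    pick (no noSpine) (inj₂ (inj₂ (t , i , j))) St = ⊥-elim (noSpine (t , i , j , St))

  biclique : V → Bool
  biclique (inj₁ _)        = true
  biclique (inj₂ (inj₁ _)) = true
  biclique (inj₂ (inj₂ _)) = false

  biclique-dense : ∀ {m} → m < d → ¬ (∃[ v ] (biclique v ≡ true × ¬ AtLeastNeighbours Adj biclique v (suc m)))
  biclique-dense m<d (inj₁ i , _ , few) = few
    ( (λ x → inj₂ (inj₁ (inject≤ x m<d)))
    , (λ eq → Finₚ.inject≤-injective m<d m<d _ _ (inj₁-injective (inj₂-injective eq)))
    , λ x → refl , (λ ()) , (i , inject≤ x m<d) , first _ _ , second _ _ )
  biclique-dense m<d (inj₂ (inj₁ j) , _ , few) = few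
    ( (λ x → inj₁ (inject≤ x m<d))
    , (λ eq → Finₚ.inject≤-injective m<d m<d _ _ (inj₁-injective eq))
    , λ x → refl , (λ ()) , (inject≤ x m<d , j) , second _ _ , first _ _ )
  biclique-dense m<d (inj₂ (inj₂ _) , () , _)

  degeneracy-least : ∀ m → IsDegenerate Adj m → d ≤ m
  degeneracy-least m m-degenerate with d ≤? m
  ... | yes d≤m = d≤m
  ... | no  d≰m =
    ⊥-elim (biclique-dense (≰⇒> d≰m) (m-degenerate biclique (inj₁ (fromℕ< (≰⇒> d≰m)) , refl)))

  skeletal-degeneracy : 2 + k′ ≤ d → HasSkeletalDegeneracy (Hedgehog d (2 + k′)) d
  skeletal-degeneracy k≤d = degenerate k≤d , degeneracy-least

proposition3p6 : (d k : ℕ) → 2 ≤ k → k ≤ d →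
    ExBound k d (Hedgehog d k) × HasSkeletalDegeneracy (Hedgehog d k) d
proposition3p6 zero    (suc (suc k′)) (s≤s (s≤s z≤n)) ()
proposition3p6 (suc r) (suc (suc k′)) (s≤s (s≤s z≤n)) k≤d =
  HedgehogExtremal.ex-bound r k′ , HedgehogSkeleton.skeletal-degeneracy (suc r) k′ k≤d
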